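{- Let $\varphi$ be a coloring on $\mathbb{N}$. Suppose that for infinitely many $n\in\mathbb{N}$, the restriction $\varphi|\{0,\dots,n\}$ is reconstructible (as a coloring on $\{0,\dots,n\}$). Then $\varphi$ is reconstructible.
   Context: A coloring on a set $X$ is a function $\varphi:[X]^2\to\{0,1\}$, where $[X]^2$ is the set of $2$-element subsets of $X$; for $Y\subseteq X$, $\varphi|Y$ is its restriction to $[Y]^2$. Let $\mathrm{hom}(\varphi)=\{H\subseteq X:\ |H|>2 \text{ and } \varphi \text{ is constant on } [H]^2\}$. A coloring $\varphi$ on $X$ is reconstructible if for every coloring $\psi$ on $X$ with $\mathrm{hom}(\psi)=\mathrm{hom}(\varphi)$ one has $\psi=\varphi$ or $\psi=1-\varphi$. -}

module Defs where

open import Level using (0ℓ)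
open import Data.Nat using (ℕ; _<_; _≤_)
open import Data.Bool using (Bool; not)
open import Data.Product using (_×_; ∃; ∃-syntax)
open import Data.Sum using (_⊎_)
open import Data.Unit using (⊤)
open import Relation.Unary using (Pred; _⊆_)
open import Relation.Binary.PropositionalEquality using (_≡_)
open import Function.Bundles using (_⇔_)

-- A coloring on a set X ⊆ ℕ: a 2-element subset {i, j} with i < j is
-- represented by the ordered pair (i , j); only values on pairs i < j with
-- i, j ∈ X matter.  Colorings on X are thus functions ℕ → ℕ → Bool,
-- considered up to agreement on [X]^2 (see _≈[_]_ below).
Coloring : Set
Coloring = ℕ → ℕ → Bool

_≈[_]_ : Coloring → Pred ℕ 0ℓ → Coloring → Set
ψ ≈[ X ] φ = ∀ i j → X i → X j → i < j → ψ i j ≡ φ i j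

compl : Coloring → Coloring
compl φ i j = not (φ i j)

MoreThanTwo : Pred ℕ 0ℓ → Set
MoreThanTwo H = ∃[ a ] ∃[ b ] ∃[ c ] (H a × H b × H c × a < b × b < c)

ConstantOn : Coloring → Pred ℕ 0ℓ → Set
ConstantOn φ H = ∃[ col ] (∀ i j → H i → H j → i < j → φ i j ≡ col)

InHom : Pred ℕ 0ℓ → Coloring → Pred ℕ 0ℓ → Set
InHom X φ H = (H ⊆ X) × MoreThanTwo H × ConstantOn φ H

SameHom : Pred ℕ 0ℓ → Coloring → Coloring → Set₁
SameHom X ψ φ = ∀ (H : Pred ℕ 0ℓ) → InHom X ψ H ⇔ InHom X φ H

Reconstructible : Pred ℕ 0ℓ → Coloring → Set₁
Reconstructible X φ =
  ∀ (ψ : Coloring) → SameHom X ψ φ → (ψ ≈[ X ] φ) ⊎ (ψ ≈[ X ] compl φ)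

Univ : Pred ℕ 0ℓ
Univ _ = ⊤

Upto : ℕ → Pred ℕ 0ℓ
Upto n k = k ≤ n

-- If hom(ψ) = hom(φ) on ℕ, then ψ and φ also have the same homogeneous sets
-- inside every segment {0, …, n}, so on each reconstructible segment ψ is φ or
-- 1 − φ. Every segment with n ≥ 1 contains the pair {0, 1}, and the value of ψ
-- there selects the same alternative on all of them; the segments exhaust ℕ.
module Submission where

open import Defs
open import Data.Nat using (ℕ; suc; _≤_; _<_; z≤n; s≤s)
open import Data.Nat.Properties using (≤-<-trans; <-trans; <⇒≤)
open import Data.Product using (_×_; _,_; ∃-syntax)
open import Data.Sum using (_⊎_; inj₁; inj₂)
open import Data.Bool using (not)
open import Data.Bool.Properties using (_≟_; not-¬)
open import Data.Unit using (tt)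
open import Relation.Nullary using (yes; no; contradiction)
open import Relation.Unary using (Pred; _⊆_)
open import Relation.Binary.PropositionalEquality using (_≡_; _≢_; refl; sym; trans)
open import Function.Bundles using (mk⇔; Equivalence)
open import Function using (case_of_)
open import Level using (0ℓ)

SameHom-⊆ : ∀ {X Y : Pred ℕ 0ℓ} {ψ φ : Coloring} → X ⊆ Y → SameHom Y ψ φ → SameHom X ψ φ
SameHom-⊆ {X} {Y} {ψ} {φ} X⊆Y same H = mk⇔ (transfer ψ φ to) (transfer φ ψ from)
  where
  open Equivalence (same H)
  transfer : ∀ χ ϑ → (InHom Y χ H → InHom Y ϑ H) → InHom X χ H → InHom X ϑ H
  transfer χ ϑ f (H⊆X , many , const) with f ((λ h → X⊆Y (H⊆X h)) , many , const)
  ... | _ , many′ , const′ = H⊆X , many′ , const′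

module _ {X : Pred ℕ 0ℓ} {ψ φ : Coloring} {a b : ℕ} (Xa : X a) (Xb : X b) (a<b : a < b) where

  agreeing-side : ψ a b ≡ φ a b
    → ψ ≈[ X ] φ ⊎ ψ ≈[ X ] compl φ → ψ ≈[ X ] φ
  agreeing-side _ (inj₁ ψ≈φ) = ψ≈φ
  agreeing-side agree (inj₂ ψ≈φᶜ) =
    contradiction (trans (sym agree) (ψ≈φᶜ a b Xa Xb a<b)) (not-¬ refl)

  disagreeing-side : ψ a b ≢ φ a b
    → ψ ≈[ X ] φ ⊎ ψ ≈[ X ] compl φ → ψ ≈[ X ] compl φ
  disagreeing-side disagree (inj₁ ψ≈φ) = contradiction (ψ≈φ a b Xa Xb a<b) disagree
  disagreeing-side _ (inj₂ ψ≈φᶜ) = ψ≈φᶜ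

≈-Univ-from-segments : ∀ {ψ χ : Coloring} → (∀ j → ∃[ n ] (j < n × ψ ≈[ Upto n ] χ)) → ψ ≈[ Univ ] χ
≈-Univ-from-segments local i j _ _ i<j with local j
... | n , j<n , ψ≈χ = ψ≈χ i j (<⇒≤ (<-trans i<j j<n)) (<⇒≤ j<n) i<j

sides-on-segments : ∀ {φ ψ : Coloring}
  → (∀ m → ∃[ n ] (m ≤ n × Reconstructible (Upto n) φ)) → SameHom Univ ψ φ
  → ∀ j → ∃[ n ] (j < n × (ψ ≈[ Upto n ] φ ⊎ ψ ≈[ Upto n ] compl φ))
sides-on-segments {ψ = ψ} rec same j with rec (suc j)
... | n , j<n , recₙ = n , j<n , recₙ ψ (SameHom-⊆ (λ _ → tt) same)

mainTheorem4 : (φ : Coloring)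
    → (∀ (m : ℕ) → ∃[ n ] (m ≤ n × Reconstructible (Upto n) φ))
    → Reconstructible Univ φ
mainTheorem4 φ rec ψ same with ψ 0 1 ≟ φ 0 1
... | yes agree = inj₁ (≈-Univ-from-segments λ j → case sides-on-segments rec same j of λ where
  (n , j<n , side) → n , j<n , agreeing-side z≤n (≤-<-trans z≤n j<n) (s≤s z≤n) agree side)
... | no disagree = inj₂ (≈-Univ-from-segments λ j → case sides-on-segments rec same j of λ where
  (n , j<n , side) → n , j<n , disagreeing-side z≤n (≤-<-trans z≤n j<n) (s≤s z≤n) disagree side)
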